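{- For every $r\ge0$ and every $\alpha\in\mathbb{Z}^m$, \[ F_{1^r}^\perp\,\mathfrak{S}_\alpha = \sum_{\substack{\beta\in\mathbb{Z}^m\\ \alpha_i-\beta_i\in\{0,1\}\ \forall i\\ |\beta|=|\alpha|-r}} \mathfrak{S}_\beta. \] In particular, if $r>m=\ell(\alpha)$ then $F_{1^r}^\perp\mathfrak{S}_\alpha=0$.
   Context: Work over $\mathbb{Q}$. $\mathrm{NSym}$ is the free associative algebra on $H_1,H_2,\dots$ ($H_0=1$, $H_{ -r}=0$ for $r>0$), graded dual to $\mathrm{QSym}$ via $\langle H_{\alpha_1}\cdots H_{\alpha_k},M_\beta\rangle=\delta_{\alpha\beta}$ ($M_\beta$ monomial quasisymmetric functions), coproduct $\Delta(H_j)=\sum_iH_i\otimes H_{j-i}$. For $F\in\mathrm{QSym}$, $F^\perp$ satisfies $\langle F^\perp(H),G\rangle=\langle H,FG\rangle$; $F_{1^i}=M_{1^i}$ is the fundamental quasisymmetric function indexed by $(1^i)$, $F_{1^0}=1$. Let $\mathbb{B}_m=\sum_{i\ge0}(-1)^iH_{m+i}F_{1^i}^\perp$ for $m\in\mathbb{Z}$ and, for any integer tuple $\alpha\in\mathbb{Z}^m$, $\mathfrak{S}_\alpha=\mathbb{B}_{\alpha_1}\cdots\mathbb{B}_{\alpha_m}(1)$. $|\beta|$ is the sum of the entries of $\beta$. -}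

module Defs where

open import Data.Nat as ℕ using (ℕ; zero; suc)
open import Data.Integer as ℤ using (ℤ; +_; -[1+_])
open import Data.Rational as ℚ using (ℚ; 0ℚ; 1ℚ)
open import Data.Bool using (Bool; true; false; if_then_else_)
open import Data.List as L using (List; []; _∷_; _++_; map; concatMap; replicate; foldr; filter; upTo)
open import Data.Nat.ListAction using (sum)
open import Data.List.Properties using (≡-dec)
open import Data.Vec as V using (Vec)
open import Data.Product using (_×_; _,_)
open import Relation.Nullary using (does)
open import Relation.Binary.PropositionalEquality using (_≡_)

-- Compositions are lists of positive naturals.  H_α ↔ α, M_α ↔ α.

Composition : Set
Composition = List ℕ

size : Composition → ℕ
size = sum

comps : ℕ → List Composition
comps zero    = [] ∷ []
comps (suc n) = concatMap step (comps n)
  where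
  step : Composition → List Composition
  step []      = (1 ∷ []) ∷ []
  step (k ∷ c) = (1 ∷ k ∷ c) ∷ (suc k ∷ c) ∷ []

-- quasi-shuffles (with multiplicity): M_γ M_β = Σ_{s ∈ qsh γ β} M_s in QSym
qsh : Composition → Composition → List Composition
qsh []      b       = b ∷ []
qsh (x ∷ a) []      = (x ∷ a) ∷ []
qsh (x ∷ a) (y ∷ b) =
  map (x ∷_) (qsh a (y ∷ b)) ++ map (y ∷_) (qsh (x ∷ a) b) ++ map (x ℕ.+ y ∷_) (qsh a b)

-- NSym over ℚ: finite formal ℚ-linear combinations of H_α

NSym : Set
NSym = List (ℚ × Composition)

zeroN : NSym
zeroN = []

oneN : NSym
oneN = (1ℚ , []) ∷ []

coeff : NSym → Composition → ℚ
coeff []            c = 0ℚ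
coeff ((q , a) ∷ x) c = if does (≡-dec ℕ._≟_ a c) then q ℚ.+ coeff x c else coeff x c

_≈N_ : NSym → NSym → Set
x ≈N y = ∀ (c : Composition) → coeff x c ≡ coeff y c

infix 4 _≈N_

scale : ℚ → NSym → NSym
scale q = map (λ { (p , a) → (q ℚ.* p , a) })

-- left multiplication by H_k (H_0 = 1, H_{-r} = 0)
Hmul : ℤ → NSym → NSym
Hmul (+ zero)    x = x
Hmul (+ (suc n)) x = map (λ { (p , a) → (p , suc n ∷ a) }) x
Hmul -[1+ n ]    x = []

-- M_γ^⊥ : the adjoint of multiplication by M_γ, i.e.
-- ⟨M_γ^⊥ H_α , M_β⟩ = ⟨H_α , M_γ M_β⟩ = #{ s ∈ qsh γ β | s = α }.
-- Only β with |β| = |α| - |γ| can contribute, so β ranges over comps (|α| ∸ |γ|).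
Mperp : Composition → NSym → NSym
Mperp γ = concatMap term
  where
  term : ℚ × Composition → NSym
  term (q , α) =
    concatMap (λ β → concatMap (λ s → if does (≡-dec ℕ._≟_ s α) then (q , β) ∷ [] else [])
                               (qsh γ β))
              (comps (size α ℕ.∸ size γ))

-- F_{1^i} = M_{1^i}
F1perp : ℕ → NSym → NSym
F1perp i = Mperp (replicate i 1)

-- a degree bound: F_{1^i}^⊥ x = 0 for every i > degBound x
degBound : NSym → ℕ
degBound = foldr (λ { (q , a) n → size a ℕ.+ n }) 0

sign : ℕ → ℚ
sign zero    = 1ℚ
sign (suc i) = ℚ.- sign i

-- 𝔹_m x = Σ_{i ≥ 0} (-1)^i H_{m+i} F_{1^i}^⊥ x   (terms i > degBound x vanish)
𝔹 : ℤ → NSym → NSym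
𝔹 m x = concatMap (λ i → scale (sign i) (Hmul (m ℤ.+ + i) (F1perp i x)))
                  (upTo (suc (degBound x)))

𝔖 : ∀ {m} → Vec ℤ m → NSym
𝔖 α = V.foldr _ 𝔹 oneN α

sumN : List NSym → NSym
sumN = L.concat

-- indexing set { β ∈ ℤ^m | α_i - β_i ∈ {0,1}, |β| = |α| - r }
-- parametrised by ε ∈ {0,1}^m with Σ ε = r, β = α - ε.

allBools : (m : ℕ) → List (Vec Bool m)
allBools zero    = V.[] ∷ []
allBools (suc m) = concatMap (λ v → (false V.∷ v) ∷ (true V.∷ v) ∷ []) (allBools m)

countTrue : ∀ {m} → Vec Bool m → ℕ
countTrue = V.foldr _ (λ b n → if b then suc n else n) 0

subtractε : ∀ {m} → Vec ℤ m → Vec Bool m → Vec ℤ m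
subtractε α ε = V.zipWith (λ a b → if b then a ℤ.- + 1 else a) α ε

betas : ∀ {m} → ℕ → Vec ℤ m → List (Vec ℤ m)
betas {m} r α = map (subtractε α) (filter (λ ε → countTrue ε ℕ.≟ r) (allBools m))

-- In the H-basis, the coefficient of H_c in M_γ^⊥ x is the sum of the coefficients of x
-- over the quasi-shuffles of γ and c. Reading this off for γ = 1^r gives the Leibniz rule
-- F_{1^r}^⊥ H_k = H_k F_{1^r}^⊥ + H_{k−1} F_{1^(r−1)}^⊥, and by induction on H-monomials the
-- operators F_{1^r}^⊥ commute with each other. Hence, term by term in the series defining 𝔹_m,
-- F_{1^r}^⊥ 𝔹_m = 𝔹_m F_{1^r}^⊥ + 𝔹_{m−1} F_{1^(r−1)}^⊥. Induction on α = (a, α′) then splits the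
-- sum over β by its first entry, a or a − 1, with r resp. r − 1 decrements left for α′.
-- If r > m there is no such β, so the sum is empty.
module Submission where

open import Defs
open import Data.Nat using (ℕ; _>_)
open import Data.Integer using (ℤ)
open import Data.Vec using (Vec)
open import Data.List using (map)
open import Data.Product using (_×_)

open import Data.Bool using (Bool; true; false; _∧_; if_then_else_)
open import Data.Nat as ℕ using (zero; suc)
import Data.Nat.Properties as ℕ
open import Data.Nat.Tactic.RingSolver using (solve-∀)
open import Data.Integer as ℤ using (-[1+_])
import Data.Integer.Tactic.RingSolver as ℤ-Solver
open import Data.Rational as ℚ using (ℚ; 0ℚ; 1ℚ; _+_; _*_)
import Data.Rational.Properties as ℚ
open import Data.Rational.Solver using (module +-*-Solver)
open +-*-Solver using (solve; con; _:+_; _:*_; _:=_)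
open import Data.List as List using (List; []; _∷_; _++_; concatMap; filter; replicate; upTo)
import Data.List.Properties as List
open import Data.List.Relation.Unary.All as All using (All; []; _∷_)
import Data.List.Relation.Unary.All.Properties as All
open import Data.Vec as Vec using ()
open import Data.Product using (_,_)
open import Function using (_∘_)
open import Relation.Nullary using (Dec; yes; no; does; ¬_)
open import Relation.Nullary.Decidable using (dec-true; dec-false)
open import Relation.Binary.Bundles using (Setoid)
open import Relation.Unary using (Decidable)
import Relation.Binary.Reasoning.Setoid
open import Relation.Binary.PropositionalEquality
  using (_≡_; refl; sym; trans; cong; cong₂; module ≡-Reasoning)

𝟙 : Bool → ℚ
𝟙 b = if b then 1ℚ else 0ℚ

𝟙-yes : ∀ {ℓ} {P : Set ℓ} (P? : Dec P) → P → 𝟙 (does P?) ≡ 1ℚ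
𝟙-yes P? p = cong 𝟙 (dec-true P? p)

𝟙-no : ∀ {ℓ} {P : Set ℓ} (P? : Dec P) → ¬ P → 𝟙 (does P?) ≡ 0ℚ
𝟙-no P? ¬p = cong 𝟙 (dec-false P? ¬p)

𝟙-∧ : ∀ a b → 𝟙 (a ∧ b) ≡ 𝟙 a * 𝟙 b
𝟙-∧ true  b = sym (ℚ.*-identityˡ (𝟙 b))
𝟙-∧ false b = sym (ℚ.*-zeroˡ (𝟙 b))

δℕ : ℕ → ℕ → ℚ
δℕ a b = 𝟙 (does (a ℕ.≟ b))

δ : Composition → Composition → ℚ
δ a c = 𝟙 (does (List.≡-dec ℕ._≟_ a c))

δ-∷ : ∀ a s b t → δ (a ∷ s) (b ∷ t) ≡ δℕ a b * δ s t
δ-∷ a s b t = 𝟙-∧ (does (a ℕ.≟ b)) (does (List.≡-dec ℕ._≟_ s t))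

δ-sym : ∀ a c → δ a c ≡ δ c a
δ-sym a c with List.≡-dec ℕ._≟_ a c
... | yes refl = sym (𝟙-yes (List.≡-dec ℕ._≟_ a a) refl)
... | no a≢c   = sym (𝟙-no (List.≡-dec ℕ._≟_ c a) (a≢c ∘ sym))

δ-substˡ : ∀ a c (g : Composition → ℚ) → δ a c * g a ≡ δ a c * g c
δ-substˡ a c g with List.≡-dec ℕ._≟_ a c
... | yes refl = refl
... | no _     = trans (ℚ.*-zeroˡ (g a)) (sym (ℚ.*-zeroˡ (g c)))

∑ : {A : Set} → List A → (A → ℚ) → ℚ
∑ []      f = 0ℚ
∑ (a ∷ l) f = f a + ∑ l f

module _ {A : Set} where

  ∑-++ : (l k : List A) (f : A → ℚ) → ∑ (l ++ k) f ≡ ∑ l f + ∑ k f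
  ∑-++ []      k f = sym (ℚ.+-identityˡ _)
  ∑-++ (a ∷ l) k f = trans (cong (f a +_) (∑-++ l k f)) (sym (ℚ.+-assoc (f a) (∑ l f) (∑ k f)))

  ∑-cong : (l : List A) {f g : A → ℚ} → (∀ a → f a ≡ g a) → ∑ l f ≡ ∑ l g
  ∑-cong []      f≗g = refl
  ∑-cong (a ∷ l) f≗g = cong₂ _+_ (f≗g a) (∑-cong l f≗g)

  ∑-+ : (l : List A) (f g : A → ℚ) → ∑ l (λ a → f a + g a) ≡ ∑ l f + ∑ l g
  ∑-+ []      f g = refl
  ∑-+ (a ∷ l) f g = trans (cong (f a + g a +_) (∑-+ l f g))
    (solve 4 (λ x y z w → (x :+ y) :+ (z :+ w) := (x :+ z) :+ (y :+ w)) refl (f a) (g a) (∑ l f) (∑ l g))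

  ∑-*ˡ : (l : List A) (q : ℚ) (f : A → ℚ) → ∑ l (λ a → q * f a) ≡ q * ∑ l f
  ∑-*ˡ []      q f = sym (ℚ.*-zeroʳ q)
  ∑-*ˡ (a ∷ l) q f = trans (cong (q * f a +_) (∑-*ˡ l q f)) (sym (ℚ.*-distribˡ-+ q (f a) (∑ l f)))

  ∑-zero : {l : List A} {f : A → ℚ} → All (λ a → f a ≡ 0ℚ) l → ∑ l f ≡ 0ℚ
  ∑-zero []            = refl
  ∑-zero (fa≡0 ∷ rest) = trans (cong₂ _+_ fa≡0 (∑-zero rest)) (ℚ.+-identityʳ 0ℚ)

  ∑-const-zero : (l : List A) → ∑ l (λ _ → 0ℚ) ≡ 0ℚ
  ∑-const-zero []      = refl
  ∑-const-zero (a ∷ l) = trans (ℚ.+-identityˡ _) (∑-const-zero l)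

  ∑-map : {B : Set} (g : B → A) (l : List B) (f : A → ℚ) → ∑ (map g l) f ≡ ∑ l (f ∘ g)
  ∑-map g []      f = refl
  ∑-map g (b ∷ l) f = cong (f (g b) +_) (∑-map g l f)

  ∑-concatMap : {B : Set} (g : B → List A) (l : List B) (f : A → ℚ) →
                ∑ (concatMap g l) f ≡ ∑ l (λ b → ∑ (g b) f)
  ∑-concatMap g []      f = refl
  ∑-concatMap g (b ∷ l) f = trans (∑-++ (g b) (concatMap g l) f) (cong (∑ (g b) f +_) (∑-concatMap g l f))

∑-[_] : {A : Set} (a : A) (f : A → ℚ) → ∑ (a ∷ []) f ≡ f a
∑-[ a ] f = ℚ.+-identityʳ (f a)

coeff-∷ : ∀ q a x c → coeff ((q , a) ∷ x) c ≡ δ a c * q + coeff x c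
coeff-∷ q a x c with does (List.≡-dec ℕ._≟_ a c)
... | true  = cong (_+ coeff x c) (sym (ℚ.*-identityˡ q))
... | false = sym (trans (cong (_+ coeff x c) (ℚ.*-zeroˡ q)) (ℚ.+-identityˡ (coeff x c)))

coeff-++ : ∀ x y c → coeff (x ++ y) c ≡ coeff x c + coeff y c
coeff-++ []            y c = sym (ℚ.+-identityˡ _)
coeff-++ ((q , a) ∷ x) y c = begin
  coeff ((q , a) ∷ x ++ y) c                ≡⟨ coeff-∷ q a (x ++ y) c ⟩
  δ a c * q + coeff (x ++ y) c              ≡⟨ cong (δ a c * q +_) (coeff-++ x y c) ⟩
  δ a c * q + (coeff x c + coeff y c)       ≡⟨ ℚ.+-assoc (δ a c * q) (coeff x c) (coeff y c) ⟨
  δ a c * q + coeff x c + coeff y c         ≡⟨ cong (_+ coeff y c) (coeff-∷ q a x c) ⟨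
  coeff ((q , a) ∷ x) c + coeff y c         ∎
  where open ≡-Reasoning

coeff-sumN : ∀ xs c → coeff (sumN xs) c ≡ ∑ xs (λ x → coeff x c)
coeff-sumN []       c = refl
coeff-sumN (x ∷ xs) c = trans (coeff-++ x (sumN xs) c) (cong (coeff x c +_) (coeff-sumN xs c))

coeff-concatMap : {A : Set} (g : A → NSym) (l : List A) (c : Composition) →
                  coeff (concatMap g l) c ≡ ∑ l (λ a → coeff (g a) c)
coeff-concatMap g l c = trans (coeff-sumN (map g l) c) (∑-map g l (λ x → coeff x c))

coeff-scale : ∀ q x c → coeff (scale q x) c ≡ q * coeff x c
coeff-scale q []            c = sym (ℚ.*-zeroʳ q)
coeff-scale q ((p , a) ∷ x) c = begin
  coeff ((q * p , a) ∷ scale q x) c         ≡⟨ coeff-∷ (q * p) a (scale q x) c ⟩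
  δ a c * (q * p) + coeff (scale q x) c     ≡⟨ cong (δ a c * (q * p) +_) (coeff-scale q x c) ⟩
  δ a c * (q * p) + q * coeff x c
    ≡⟨ solve 4 (λ d q p y → d :* (q :* p) :+ q :* y := q :* (d :* p :+ y)) refl (δ a c) q p (coeff x c) ⟩
  q * (δ a c * p + coeff x c)               ≡⟨ cong (q *_) (coeff-∷ p a x c) ⟨
  q * coeff ((p , a) ∷ x) c                 ∎
  where open ≡-Reasoning

coeff-Hmul-[] : ∀ n x → coeff (Hmul (ℤ.+ suc n) x) [] ≡ 0ℚ
coeff-Hmul-[] n []      = refl
coeff-Hmul-[] n (_ ∷ x) = coeff-Hmul-[] n x

coeff-Hmul-∷ : ∀ n x h t → coeff (Hmul (ℤ.+ suc n) x) (h ∷ t) ≡ δℕ (suc n) h * coeff x t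
coeff-Hmul-∷ n []            h t = sym (ℚ.*-zeroʳ (δℕ (suc n) h))
coeff-Hmul-∷ n ((q , a) ∷ x) h t = begin
  coeff ((q , suc n ∷ a) ∷ Hmul (ℤ.+ suc n) x) (h ∷ t)
    ≡⟨ coeff-∷ q (suc n ∷ a) (Hmul (ℤ.+ suc n) x) (h ∷ t) ⟩
  δ (suc n ∷ a) (h ∷ t) * q + coeff (Hmul (ℤ.+ suc n) x) (h ∷ t)
    ≡⟨ cong₂ (λ u v → u * q + v) (δ-∷ (suc n) a h t) (coeff-Hmul-∷ n x h t) ⟩
  δℕ (suc n) h * δ a t * q + δℕ (suc n) h * coeff x t
    ≡⟨ solve 4 (λ d e q y → d :* e :* q :+ d :* y := d :* (e :* q :+ y)) refl (δℕ (suc n) h) (δ a t) q (coeff x t) ⟩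
  δℕ (suc n) h * (δ a t * q + coeff x t)
    ≡⟨ cong (δℕ (suc n) h *_) (coeff-∷ q a x t) ⟨
  δℕ (suc n) h * coeff ((q , a) ∷ x) t ∎
  where open ≡-Reasoning

-- A record, so that x and y can be inferred from a proof of x ≈ y.
infix 4 _≈_
record _≈_ (x y : NSym) : Set where
  constructor mk≈
  field coeff-≈ : x ≈N y
open _≈_ public

≈-setoid : Setoid _ _
≈-setoid = record
  { Carrier       = NSym
  ; _≈_           = _≈_
  ; isEquivalence = record
    { refl  = mk≈ λ _ → refl
    ; sym   = λ x≈y → mk≈ λ c → sym (coeff-≈ x≈y c)
    ; trans = λ x≈y y≈z → mk≈ λ c → trans (coeff-≈ x≈y c) (coeff-≈ y≈z c)
    }
  }

module ≈ = Setoid ≈-setoid using (refl; sym; trans; reflexive)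
module ≈-Reasoning = Relation.Binary.Reasoning.Setoid ≈-setoid

++-cong : ∀ {x x′ y y′} → x ≈ x′ → y ≈ y′ → x ++ y ≈ x′ ++ y′
++-cong {x} {x′} {y} {y′} x≈x′ y≈y′ = mk≈ λ c → begin
  coeff (x ++ y) c             ≡⟨ coeff-++ x y c ⟩
  coeff x c + coeff y c        ≡⟨ cong₂ _+_ (coeff-≈ x≈x′ c) (coeff-≈ y≈y′ c) ⟩
  coeff x′ c + coeff y′ c      ≡⟨ coeff-++ x′ y′ c ⟨
  coeff (x′ ++ y′) c           ∎
  where open ≡-Reasoning

++-identityʳ : ∀ x → x ++ [] ≈ x
++-identityʳ x = ≈.reflexive (List.++-identityʳ x)

++-interchange : ∀ a b c d → (a ++ b) ++ (c ++ d) ≈ (a ++ c) ++ (b ++ d)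
++-interchange a b c d = mk≈ λ k → begin
  coeff ((a ++ b) ++ (c ++ d)) k
    ≡⟨ trans (coeff-++ (a ++ b) (c ++ d) k) (cong₂ _+_ (coeff-++ a b k) (coeff-++ c d k)) ⟩
  (coeff a k + coeff b k) + (coeff c k + coeff d k)
    ≡⟨ solve 4 (λ a b c d → (a :+ b) :+ (c :+ d) := (a :+ c) :+ (b :+ d)) refl (coeff a k) (coeff b k) (coeff c k) (coeff d k) ⟩
  (coeff a k + coeff c k) + (coeff b k + coeff d k)
    ≡⟨ trans (coeff-++ (a ++ c) (b ++ d) k) (cong₂ _+_ (coeff-++ a c k) (coeff-++ b d k)) ⟨
  coeff ((a ++ c) ++ (b ++ d)) k ∎
  where open ≡-Reasoning

concatMap-cong : {A : Set} {f g : A → NSym} (l : List A) → (∀ a → f a ≈ g a) → concatMap f l ≈ concatMap g l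
concatMap-cong []      f≈g = ≈.refl
concatMap-cong (a ∷ l) f≈g = ++-cong (f≈g a) (concatMap-cong l f≈g)

concatMap-++ : {A : Set} (f g : A → NSym) (l : List A) →
               concatMap (λ a → f a ++ g a) l ≈ concatMap f l ++ concatMap g l
concatMap-++ f g l = mk≈ λ c → begin
  coeff (concatMap (λ a → f a ++ g a) l) c
    ≡⟨ coeff-concatMap _ l c ⟩
  ∑ l (λ a → coeff (f a ++ g a) c)
    ≡⟨ ∑-cong l (λ a → coeff-++ (f a) (g a) c) ⟩
  ∑ l (λ a → coeff (f a) c + coeff (g a) c)
    ≡⟨ ∑-+ l _ _ ⟩
  ∑ l (λ a → coeff (f a) c) + ∑ l (λ a → coeff (g a) c)
    ≡⟨ cong₂ _+_ (coeff-concatMap f l c) (coeff-concatMap g l c) ⟨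
  coeff (concatMap f l) c + coeff (concatMap g l) c
    ≡⟨ coeff-++ (concatMap f l) (concatMap g l) c ⟨
  coeff (concatMap f l ++ concatMap g l) c ∎
  where open ≡-Reasoning

scale-cong : ∀ q {x y} → x ≈ y → scale q x ≈ scale q y
scale-cong q {x} {y} x≈y = mk≈ λ c →
  trans (coeff-scale q x c) (trans (cong (q *_) (coeff-≈ x≈y c)) (sym (coeff-scale q y c)))

scale-++ : ∀ q x y → scale q (x ++ y) ≈ scale q x ++ scale q y
scale-++ q x y = ≈.reflexive (List.map-++ _ x y)

Hmul-[] : ∀ k → Hmul k [] ≡ []
Hmul-[] (ℤ.+ zero)  = refl
Hmul-[] (ℤ.+ suc n) = refl
Hmul-[] -[1+ n ]    = refl

Hmul-cong : ∀ k {x y} → x ≈ y → Hmul k x ≈ Hmul k y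
Hmul-cong (ℤ.+ zero)  x≈y = x≈y
Hmul-cong -[1+ n ]    x≈y = ≈.refl
Hmul-cong (ℤ.+ suc n) {x} {y} x≈y = mk≈ λ where
  []      → trans (coeff-Hmul-[] n x) (sym (coeff-Hmul-[] n y))
  (h ∷ t) → trans (coeff-Hmul-∷ n x h t)
              (trans (cong (δℕ (suc n) h *_) (coeff-≈ x≈y t)) (sym (coeff-Hmul-∷ n y h t)))

Hmul-++ : ∀ k x y → Hmul k (x ++ y) ≈ Hmul k x ++ Hmul k y
Hmul-++ (ℤ.+ zero)  x y = ≈.refl
Hmul-++ (ℤ.+ suc n) x y = ≈.reflexive (List.map-++ _ x y)
Hmul-++ -[1+ n ]    x y = ≈.refl

-- The operators M_γ^⊥ in coordinates

allPositive : Composition → Bool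
allPositive []          = true
allPositive (zero ∷ c)  = false
allPositive (suc _ ∷ c) = allPositive c

𝟙-positive : Composition → ℚ
𝟙-positive c = 𝟙 (allPositive c)

raiseHead : (Composition → ℚ) → Composition → ℚ
raiseHead f []      = 0ℚ
raiseHead f (k ∷ d) = f (suc k ∷ d)

∑-comps-suc : ∀ n (f : Composition → ℚ) →
              ∑ (comps (suc n)) f ≡ ∑ (comps n) (λ d → f (1 ∷ d)) + ∑ (comps n) (raiseHead f)
∑-comps-suc n f = begin
  ∑ (comps (suc n)) f
    ≡⟨ cong (λ l → ∑ l f) (List.concatMap-cong (λ { [] → refl ; (_ ∷ _) → refl }) (comps n)) ⟩
  ∑ (concatMap extend (comps n)) f
    ≡⟨ ∑-concatMap extend (comps n) f ⟩
  ∑ (comps n) (λ d → ∑ (extend d) f)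
    ≡⟨ ∑-cong (comps n) ∑-extend ⟩
  ∑ (comps n) (λ d → f (1 ∷ d) + raiseHead f d)
    ≡⟨ ∑-+ (comps n) _ _ ⟩
  ∑ (comps n) (λ d → f (1 ∷ d)) + ∑ (comps n) (raiseHead f) ∎
  where
  open ≡-Reasoning
  extend : Composition → List Composition
  extend []      = (1 ∷ []) ∷ []
  extend (k ∷ d) = (1 ∷ k ∷ d) ∷ (suc k ∷ d) ∷ []
  ∑-extend : ∀ d → ∑ (extend d) f ≡ f (1 ∷ d) + raiseHead f d
  ∑-extend []      = refl
  ∑-extend (k ∷ d) = cong (f (1 ∷ k ∷ d) +_) (ℚ.+-identityʳ _)

multiplicity-comps : ∀ n c → ∑ (comps n) (λ β → δ β c) ≡ δℕ (size c) n * 𝟙-positive c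
multiplicity-comps zero    []          = refl
multiplicity-comps zero    (zero ∷ c)  = sym (ℚ.*-zeroʳ (δℕ (size c) 0))
multiplicity-comps zero    (suc k ∷ c) = sym (ℚ.*-zeroˡ (𝟙-positive c))
multiplicity-comps (suc n) c = trans (∑-comps-suc n (λ β → δ β c)) (split c)
  where
  M : Composition → ℚ
  M c = ∑ (comps n) (λ β → δ β c)
  zeros : ∀ {g : Composition → ℚ} → (∀ d → g d ≡ 0ℚ) → ∑ (comps n) g ≡ 0ℚ
  zeros g≡0 = trans (∑-cong (comps n) g≡0) (∑-const-zero (comps n))
  lowerHead : ∀ h c → ∑ (comps n) (raiseHead (λ β → δ β (suc h ∷ c))) ≡ M (h ∷ c)
  lowerHead h c = ∑-cong (comps n) λ { [] → refl ; (_ ∷ _) → refl }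
  split : ∀ c → ∑ (comps n) (λ d → δ (1 ∷ d) c) + ∑ (comps n) (raiseHead (λ β → δ β c))
              ≡ δℕ (size c) (suc n) * 𝟙-positive c
  split [] = trans (cong₂ _+_ (zeros (λ _ → refl)) (zeros λ { [] → refl ; (_ ∷ _) → refl })) refl
  split (zero ∷ c) = trans (cong₂ _+_ (zeros (λ _ → refl)) (zeros λ { [] → refl ; (_ ∷ _) → refl }))
    (trans (ℚ.+-identityʳ 0ℚ) (sym (ℚ.*-zeroʳ (δℕ (size c) (suc n)))))
  split (suc zero ∷ c) = begin
    M c + ∑ (comps n) (raiseHead (λ β → δ β (1 ∷ c)))  ≡⟨ cong₂ _+_ (multiplicity-comps n c) (lowerHead 0 c) ⟩
    p + M (0 ∷ c)                                      ≡⟨ cong (p +_) (multiplicity-comps n (0 ∷ c)) ⟩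
    p + δℕ (size c) n * 0ℚ                             ≡⟨ cong (p +_) (ℚ.*-zeroʳ (δℕ (size c) n)) ⟩
    p + 0ℚ                                             ≡⟨ ℚ.+-identityʳ p ⟩
    p                                                  ∎
    where
    open ≡-Reasoning
    p = δℕ (size c) n * 𝟙-positive c
  split (suc (suc j) ∷ c) =
    trans (cong₂ _+_ (zeros (λ _ → refl)) (trans (lowerHead (suc j) c) (multiplicity-comps n (suc j ∷ c))))
          (ℚ.+-identityˡ _)

qsh-size : ∀ a b → All (λ s → size s ≡ size a ℕ.+ size b) (qsh a b)
qsh-size []      b       = refl ∷ []
qsh-size (x ∷ a) []      = sym (ℕ.+-identityʳ _) ∷ []
qsh-size (x ∷ a) (y ∷ b) =
  All.++⁺ (prepend x (λ e → trans (cong (x ℕ.+_) e) (assocˡ x (size a) y (size b))) (qsh-size a (y ∷ b)))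
  (All.++⁺ (prepend y (λ e → trans (cong (y ℕ.+_) e) (assocᵐ x (size a) y (size b))) (qsh-size (x ∷ a) b))
           (prepend (x ℕ.+ y) (λ e → trans (cong (x ℕ.+ y ℕ.+_) e) (assocʳ x (size a) y (size b))) (qsh-size a b)))
  where
  prepend : ∀ z {n m} {l : List Composition} → (∀ {s} → size s ≡ n → z ℕ.+ size s ≡ m) →
            All (λ s → size s ≡ n) l → All (λ s → size s ≡ m) (map (z ∷_) l)
  prepend z f all = All.map⁺ (All.map (λ {s} → f {s}) all)
  assocˡ : ∀ x a y b → x ℕ.+ (a ℕ.+ (y ℕ.+ b)) ≡ (x ℕ.+ a) ℕ.+ (y ℕ.+ b)
  assocˡ = solve-∀
  assocᵐ : ∀ x a y b → y ℕ.+ ((x ℕ.+ a) ℕ.+ b) ≡ (x ℕ.+ a) ℕ.+ (y ℕ.+ b)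
  assocᵐ = solve-∀
  assocʳ : ∀ x a y b → (x ℕ.+ y) ℕ.+ (a ℕ.+ b) ≡ (x ℕ.+ a) ℕ.+ (y ℕ.+ b)
  assocʳ = solve-∀

∑-comps-δ : ∀ n c (g : Composition → ℚ) →
            ∑ (comps n) (λ β → δ β c * g β) ≡ δℕ (size c) n * 𝟙-positive c * g c
∑-comps-δ n c g = begin
  ∑ (comps n) (λ β → δ β c * g β)                 ≡⟨ ∑-cong (comps n) (λ β → δ-substˡ β c g) ⟩
  ∑ (comps n) (λ β → δ β c * g c)                 ≡⟨ ∑-cong (comps n) (λ β → ℚ.*-comm (δ β c) (g c)) ⟩
  ∑ (comps n) (λ β → g c * δ β c)                 ≡⟨ ∑-*ˡ (comps n) (g c) (λ β → δ β c) ⟩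
  g c * ∑ (comps n) (λ β → δ β c)                 ≡⟨ cong (g c *_) (multiplicity-comps n c) ⟩
  g c * (δℕ (size c) n * 𝟙-positive c)           ≡⟨ ℚ.*-comm (g c) _ ⟩
  δℕ (size c) n * 𝟙-positive c * g c              ∎
  where open ≡-Reasoning

Mperp-term : Composition → ℚ → Composition → NSym
Mperp-term γ q α =
  concatMap (λ β → concatMap (λ s → if does (List.≡-dec ℕ._≟_ s α) then (q , β) ∷ [] else []) (qsh γ β))
            (comps (size α ℕ.∸ size γ))

coeff-Mperp-term : ∀ γ q α c →
                   coeff (Mperp-term γ q α) c ≡ 𝟙-positive c * ∑ (qsh γ c) (λ s → δ α s * q)
coeff-Mperp-term γ q α c = begin
  coeff (Mperp-term γ q α) c
    ≡⟨ coeff-concatMap _ (comps n) c ⟩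
  ∑ (comps n) (λ β → coeff (concatMap (λ s → if does (List.≡-dec ℕ._≟_ s α) then (q , β) ∷ [] else []) (qsh γ β)) c)
    ≡⟨ ∑-cong (comps n) (λ β → trans (coeff-concatMap _ (qsh γ β) c) (∑-cong (qsh γ β) (coeff-if β))) ⟩
  ∑ (comps n) (λ β → ∑ (qsh γ β) (λ s → δ s α * (δ β c * q)))
    ≡⟨ ∑-cong (comps n) (λ β → ∑-cong (qsh γ β) (λ s → trans (cong (_* (δ β c * q)) (δ-sym s α))
                                                           (swap (δ α s) (δ β c) q))) ⟩
  ∑ (comps n) (λ β → ∑ (qsh γ β) (λ s → δ β c * (δ α s * q)))
    ≡⟨ ∑-cong (comps n) (λ β → ∑-*ˡ (qsh γ β) (δ β c) (λ s → δ α s * q)) ⟩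
  ∑ (comps n) (λ β → δ β c * G β)
    ≡⟨ ∑-comps-δ n c G ⟩
  δℕ (size c) n * 𝟙-positive c * G c
    ≡⟨ solve 3 (λ d p g → d :* p :* g := p :* (d :* g)) refl (δℕ (size c) n) (𝟙-positive c) (G c) ⟩
  𝟙-positive c * (δℕ (size c) n * G c)
    ≡⟨ cong (𝟙-positive c *_) sizes-match ⟩
  𝟙-positive c * G c ∎
  where
  open ≡-Reasoning
  n = size α ℕ.∸ size γ
  G : Composition → ℚ
  G β = ∑ (qsh γ β) (λ s → δ α s * q)
  coeff-if : ∀ β s → coeff (if does (List.≡-dec ℕ._≟_ s α) then (q , β) ∷ [] else []) c ≡ δ s α * (δ β c * q)
  coeff-if β s with does (List.≡-dec ℕ._≟_ s α)
  ... | true  = trans (coeff-∷ q β [] c) (trans (ℚ.+-identityʳ (δ β c * q)) (sym (ℚ.*-identityˡ (δ β c * q))))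
  ... | false = sym (ℚ.*-zeroˡ (δ β c * q))
  swap : ∀ a b q → a * (b * q) ≡ b * (a * q)
  swap = solve 3 (λ a b q → a :* (b :* q) := b :* (a :* q)) refl
  -- n = |α| ∸ |γ| is truncated; for |c| ≠ n no quasi-shuffle of γ and c has the size of α.
  sizes-match : δℕ (size c) n * G c ≡ G c
  sizes-match with size α ℕ.≟ size γ ℕ.+ size c
  ... | yes |α|≡ = trans (cong (_* G c) (𝟙-yes (size c ℕ.≟ n) (sym n≡|c|))) (ℚ.*-identityˡ (G c))
    where
    n≡|c| : n ≡ size c
    n≡|c| = trans (cong (ℕ._∸ size γ) |α|≡) (ℕ.m+n∸m≡n (size γ) (size c))
  ... | no |α|≢ = trans (cong (δℕ (size c) n *_) G≡0) (trans (ℚ.*-zeroʳ (δℕ (size c) n)) (sym G≡0))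
    where
    term≡0 : ∀ {s} → size s ≡ size γ ℕ.+ size c → δ α s * q ≡ 0ℚ
    term≡0 |s|≡ = trans (cong (_* q) (𝟙-no (List.≡-dec ℕ._≟_ α _) λ { refl → |α|≢ |s|≡ })) (ℚ.*-zeroˡ q)
    G≡0 : G c ≡ 0ℚ
    G≡0 = ∑-zero (All.map term≡0 (qsh-size γ c))

-- Mperp only produces H_β for compositions β with positive parts, hence the factor 𝟙-positive c.
coeff-Mperp : ∀ γ x c → coeff (Mperp γ x) c ≡ 𝟙-positive c * ∑ (qsh γ c) (coeff x)
coeff-Mperp γ []            c =
  sym (trans (cong (𝟙-positive c *_) (∑-const-zero (qsh γ c))) (ℚ.*-zeroʳ (𝟙-positive c)))
coeff-Mperp γ ((q , α) ∷ x) c = begin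
  coeff (Mperp-term γ q α ++ Mperp γ x) c
    ≡⟨ coeff-++ (Mperp-term γ q α) (Mperp γ x) c ⟩
  coeff (Mperp-term γ q α) c + coeff (Mperp γ x) c
    ≡⟨ cong₂ _+_ (coeff-Mperp-term γ q α c) (coeff-Mperp γ x c) ⟩
  p * ∑ (qsh γ c) (λ s → δ α s * q) + p * ∑ (qsh γ c) (coeff x)
    ≡⟨ ℚ.*-distribˡ-+ p _ _ ⟨
  p * (∑ (qsh γ c) (λ s → δ α s * q) + ∑ (qsh γ c) (coeff x))
    ≡⟨ cong (p *_) (∑-+ (qsh γ c) _ _) ⟨
  p * ∑ (qsh γ c) (λ s → δ α s * q + coeff x s)
    ≡⟨ cong (p *_) (∑-cong (qsh γ c) (λ s → coeff-∷ q α x s)) ⟨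
  p * ∑ (qsh γ c) (coeff ((q , α) ∷ x)) ∎
  where
  open ≡-Reasoning
  p = 𝟙-positive c

Mperp-cong : ∀ γ {x y} → x ≈ y → Mperp γ x ≈ Mperp γ y
Mperp-cong γ {x} {y} x≈y = mk≈ λ c → trans (coeff-Mperp γ x c)
  (trans (cong (𝟙-positive c *_) (∑-cong (qsh γ c) (coeff-≈ x≈y))) (sym (coeff-Mperp γ y c)))

Mperp-++ : ∀ γ x y → Mperp γ (x ++ y) ≈ Mperp γ x ++ Mperp γ y
Mperp-++ γ x y = ≈.reflexive (List.concatMap-++ _ x y)

Mperp-concatMap : {A : Set} (γ : Composition) (g : A → NSym) (l : List A) →
                  Mperp γ (concatMap g l) ≈ concatMap (Mperp γ ∘ g) l
Mperp-concatMap γ g []      = ≈.refl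
Mperp-concatMap γ g (a ∷ l) = ≈.trans (Mperp-++ γ (g a) (concatMap g l)) (++-cong ≈.refl (Mperp-concatMap γ g l))

Mperp-scale : ∀ γ q x → Mperp γ (scale q x) ≈ scale q (Mperp γ x)
Mperp-scale γ q x = mk≈ λ c → begin
  coeff (Mperp γ (scale q x)) c                          ≡⟨ coeff-Mperp γ (scale q x) c ⟩
  𝟙-positive c * ∑ (qsh γ c) (coeff (scale q x))    ≡⟨ cong (𝟙-positive c *_) (∑-cong (qsh γ c) (coeff-scale q x)) ⟩
  𝟙-positive c * ∑ (qsh γ c) (λ s → q * coeff x s)  ≡⟨ cong (𝟙-positive c *_) (∑-*ˡ (qsh γ c) q (coeff x)) ⟩
  𝟙-positive c * (q * ∑ (qsh γ c) (coeff x))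
    ≡⟨ solve 3 (λ p q s → p :* (q :* s) := q :* (p :* s)) refl (𝟙-positive c) q (∑ (qsh γ c) (coeff x)) ⟩
  q * (𝟙-positive c * ∑ (qsh γ c) (coeff x))            ≡⟨ cong (q *_) (coeff-Mperp γ x c) ⟨
  q * coeff (Mperp γ x) c                                ≡⟨ coeff-scale q (Mperp γ x) c ⟨
  coeff (scale q (Mperp γ x)) c                          ∎
  where open ≡-Reasoning

-- Leibniz rule and commutativity of the F_{1^r}^⊥

ones : ℕ → Composition
ones r = replicate r 1

qsh-[]ʳ : ∀ a → qsh a [] ≡ a ∷ []
qsh-[]ʳ []      = refl
qsh-[]ʳ (_ ∷ _) = refl

∑-qsh-∷ : ∀ x a y b (f : Composition → ℚ) →
          ∑ (qsh (x ∷ a) (y ∷ b)) f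
            ≡ ∑ (qsh a (y ∷ b)) (f ∘ (x ∷_)) + (∑ (qsh (x ∷ a) b) (f ∘ (y ∷_)) + ∑ (qsh a b) (f ∘ (x ℕ.+ y ∷_)))
∑-qsh-∷ x a y b f = begin
  ∑ (map (x ∷_) A ++ map (y ∷_) B ++ map (x ℕ.+ y ∷_) C) f
    ≡⟨ ∑-++ (map (x ∷_) A) _ f ⟩
  ∑ (map (x ∷_) A) f + ∑ (map (y ∷_) B ++ map (x ℕ.+ y ∷_) C) f
    ≡⟨ cong (∑ (map (x ∷_) A) f +_) (∑-++ (map (y ∷_) B) _ f) ⟩
  ∑ (map (x ∷_) A) f + (∑ (map (y ∷_) B) f + ∑ (map (x ℕ.+ y ∷_) C) f)
    ≡⟨ cong₂ _+_ (∑-map (x ∷_) A f) (cong₂ _+_ (∑-map (y ∷_) B f) (∑-map (x ℕ.+ y ∷_) C f)) ⟩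
  ∑ A (f ∘ (x ∷_)) + (∑ B (f ∘ (y ∷_)) + ∑ C (f ∘ (x ℕ.+ y ∷_))) ∎
  where
  open ≡-Reasoning
  A = qsh a (y ∷ b)
  B = qsh (x ∷ a) b
  C = qsh a b

∑-qsh-∷-vanish : ∀ x a y b {f : Composition → ℚ} →
                 (∀ s → f (x ∷ s) ≡ 0ℚ) → (∀ s → f (y ∷ s) ≡ 0ℚ) → (∀ s → f (x ℕ.+ y ∷ s) ≡ 0ℚ) →
                 ∑ (qsh (x ∷ a) (y ∷ b)) f ≡ 0ℚ
∑-qsh-∷-vanish x a y b {f} fx≡0 fy≡0 fxy≡0 = begin
  ∑ (qsh (x ∷ a) (y ∷ b)) f      ≡⟨ ∑-qsh-∷ x a y b f ⟩
  ∑ A (f ∘ (x ∷_)) + (∑ B (f ∘ (y ∷_)) + ∑ C (f ∘ (x ℕ.+ y ∷_)))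
    ≡⟨ cong₂ _+_ (vanish A fx≡0) (cong₂ _+_ (vanish B fy≡0) (vanish C fxy≡0)) ⟩
  0ℚ + (0ℚ + 0ℚ)                 ≡⟨⟩
  0ℚ                             ∎
  where
  open ≡-Reasoning
  A = qsh a (y ∷ b)
  B = qsh (x ∷ a) b
  C = qsh a b
  vanish : ∀ l {g : Composition → ℚ} → (∀ s → g s ≡ 0ℚ) → ∑ l g ≡ 0ℚ
  vanish l g≡0 = trans (∑-cong l g≡0) (∑-const-zero l)

SupportedOnCompositions : NSym → Set
SupportedOnCompositions x = ∀ c → allPositive c ≡ false → coeff x c ≡ 0ℚ

Mperp-supported : ∀ γ x → SupportedOnCompositions (Mperp γ x)
Mperp-supported γ x c c≢pos =
  trans (coeff-Mperp γ x c) (trans (cong (λ b → 𝟙 b * S) c≢pos) (ℚ.*-zeroˡ S))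
  where S = ∑ (qsh γ c) (coeff x)

Hmul-supported : ∀ k x → SupportedOnCompositions x → SupportedOnCompositions (Hmul k x)
Hmul-supported (ℤ.+ zero)  x sx = sx
Hmul-supported -[1+ n ]    x sx c _ = refl
Hmul-supported (ℤ.+ suc n) x sx (zero ∷ t) _ =
  trans (coeff-Hmul-∷ n x 0 t) (ℚ.*-zeroˡ (coeff x t))
Hmul-supported (ℤ.+ suc n) x sx (suc h ∷ t) t≢pos =
  trans (coeff-Hmul-∷ n x (suc h) t)
        (trans (cong (δℕ (suc n) (suc h) *_) (sx t t≢pos)) (ℚ.*-zeroʳ (δℕ (suc n) (suc h))))

coeff-Mperp-[] : ∀ γ x → coeff (Mperp γ x) [] ≡ coeff x γ
coeff-Mperp-[] γ x = begin
  coeff (Mperp γ x) []         ≡⟨ coeff-Mperp γ x [] ⟩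
  1ℚ * ∑ (qsh γ []) (coeff x)  ≡⟨ ℚ.*-identityˡ _ ⟩
  ∑ (qsh γ []) (coeff x)       ≡⟨ cong (λ l → ∑ l (coeff x)) (qsh-[]ʳ γ) ⟩
  ∑ (γ ∷ []) (coeff x)         ≡⟨ ∑-[ γ ] (coeff x) ⟩
  coeff x γ                    ∎
  where open ≡-Reasoning

coeff-F1perp-0 : ∀ x c → coeff (F1perp 0 x) c ≡ 𝟙-positive c * coeff x c
coeff-F1perp-0 x c = trans (coeff-Mperp [] x c) (cong (𝟙-positive c *_) (∑-[ c ] (coeff x)))

∑-Hmul-∷ : ∀ n h l y → ∑ l (coeff (Hmul (ℤ.+ suc n) y) ∘ (h ∷_)) ≡ δℕ (suc n) h * ∑ l (coeff y)
∑-Hmul-∷ n h l y = trans (∑-cong l (coeff-Hmul-∷ n y h)) (∑-*ˡ l (δℕ (suc n) h) (coeff y))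

F1perp-Hmul-0 : ∀ k y → F1perp 0 (Hmul k y) ≈ Hmul k (F1perp 0 y)
F1perp-Hmul-0 (ℤ.+ zero)  y = ≈.refl
F1perp-Hmul-0 -[1+ n ]    y = ≈.refl
F1perp-Hmul-0 (ℤ.+ suc n) y = mk≈ λ where
    []          → trans (coeff-Mperp-[] [] (Hmul (ℤ.+ suc n) y))
                        (trans (coeff-Hmul-[] n y) (sym (coeff-Hmul-[] n (F1perp 0 y))))
    (zero ∷ t)  → trans (Mperp-supported [] (Hmul (ℤ.+ suc n) y) (zero ∷ t) refl)
                        (sym (Hmul-supported (ℤ.+ suc n) (F1perp 0 y) (Mperp-supported [] y) (zero ∷ t) refl))
    (suc h ∷ t) → begin
      coeff (F1perp 0 (Hmul (ℤ.+ suc n) y)) (suc h ∷ t)  ≡⟨ coeff-F1perp-0 (Hmul (ℤ.+ suc n) y) (suc h ∷ t) ⟩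
      𝟙-positive t * coeff (Hmul (ℤ.+ suc n) y) (suc h ∷ t)
        ≡⟨ cong (𝟙-positive t *_) (coeff-Hmul-∷ n y (suc h) t) ⟩
      𝟙-positive t * (δℕ (suc n) (suc h) * coeff y t)
        ≡⟨ solve 3 (λ p d y → p :* (d :* y) := d :* (p :* y)) refl (𝟙-positive t) (δℕ (suc n) (suc h)) (coeff y t) ⟩
      δℕ (suc n) (suc h) * (𝟙-positive t * coeff y t)
        ≡⟨ cong (δℕ (suc n) (suc h) *_) (coeff-F1perp-0 y t) ⟨
      δℕ (suc n) (suc h) * coeff (F1perp 0 y) t           ≡⟨ coeff-Hmul-∷ n (F1perp 0 y) (suc h) t ⟨
      coeff (Hmul (ℤ.+ suc n) (F1perp 0 y)) (suc h ∷ t)  ∎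
  where open ≡-Reasoning

F1perp-Hmul-suc : ∀ r k y →
                  F1perp (suc r) (Hmul k y) ≈ Hmul k (F1perp (suc r) y) ++ Hmul (k ℤ.- ℤ.+ 1) (F1perp r y)
F1perp-Hmul-suc r (ℤ.+ zero)  y = ≈.sym (++-identityʳ _)
F1perp-Hmul-suc r -[1+ n ]    y = ≈.refl
F1perp-Hmul-suc r (ℤ.+ suc n) y = mk≈ λ where
    []          → trans (coeff-Mperp-[] (ones (suc r)) (Hmul (ℤ.+ suc n) y))
                    (trans (coeff-Hmul-∷ n y 1 (ones r))
                    (trans (at-[] n)
                    (trans (cong (_+ coeff (Hmul (ℤ.+ n) (F1perp r y)) []) (sym (coeff-Hmul-[] n (F1perp (suc r) y))))
                           (sym (coeff-++ (Hmul (ℤ.+ suc n) (F1perp (suc r) y)) (Hmul (ℤ.+ n) (F1perp r y)) [])))))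
    (zero ∷ t)  → trans (Mperp-supported (ones (suc r)) (Hmul (ℤ.+ suc n) y) (zero ∷ t) refl)
                    (sym (trans (coeff-++ (Hmul (ℤ.+ suc n) (F1perp (suc r) y)) (Hmul (ℤ.+ n) (F1perp r y)) (zero ∷ t))
                    (trans (cong₂ _+_ (Hmul-supported (ℤ.+ suc n) (F1perp (suc r) y) (Mperp-supported (ones (suc r)) y)
                                                      (zero ∷ t) refl)
                                      (Hmul-supported (ℤ.+ n) (F1perp r y) (Mperp-supported (ones r) y) (zero ∷ t) refl))
                           (ℚ.+-identityʳ 0ℚ))))
    (suc h ∷ t) → at-∷ h t
  where
  open ≡-Reasoning
  Hy = Hmul (ℤ.+ suc n) y
  at-∷ : ∀ h t → coeff (F1perp (suc r) Hy) (suc h ∷ t)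
               ≡ coeff (Hmul (ℤ.+ suc n) (F1perp (suc r) y) ++ Hmul (ℤ.+ n) (F1perp r y)) (suc h ∷ t)
  at-∷ h t = begin
    coeff (F1perp (suc r) Hy) (suc h ∷ t)
      ≡⟨ coeff-Mperp (ones (suc r)) Hy (suc h ∷ t) ⟩
    p * ∑ (qsh (1 ∷ ones r) (suc h ∷ t)) (coeff Hy)
      ≡⟨ cong (p *_) (∑-qsh-∷ 1 (ones r) (suc h) t (coeff Hy)) ⟩
    p * (∑ A (coeff Hy ∘ (1 ∷_)) + (∑ B (coeff Hy ∘ (suc h ∷_)) + ∑ C (coeff Hy ∘ (suc (suc h) ∷_))))
      ≡⟨ cong (p *_) (cong₂ _+_ (∑-Hmul-∷ n 1 A y) (cong₂ _+_ (∑-Hmul-∷ n (suc h) B y) (∑-Hmul-∷ n (suc (suc h)) C y))) ⟩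
    p * (δℕ (suc n) 1 * SA + (δℕ (suc n) (suc h) * SB + δℕ n (suc h) * SC))
      ≡⟨ regroup n ⟩
    δℕ (suc n) (suc h) * (p * SB) + coeff (Hmul (ℤ.+ n) (F1perp r y)) (suc h ∷ t)
      ≡⟨ cong (λ u → δℕ (suc n) (suc h) * u + coeff (Hmul (ℤ.+ n) (F1perp r y)) (suc h ∷ t))
              (coeff-Mperp (ones (suc r)) y t) ⟨
    δℕ (suc n) (suc h) * coeff (F1perp (suc r) y) t + coeff (Hmul (ℤ.+ n) (F1perp r y)) (suc h ∷ t)
      ≡⟨ cong (_+ coeff (Hmul (ℤ.+ n) (F1perp r y)) (suc h ∷ t)) (coeff-Hmul-∷ n (F1perp (suc r) y) (suc h) t) ⟨
    coeff (Hmul (ℤ.+ suc n) (F1perp (suc r) y)) (suc h ∷ t) + coeff (Hmul (ℤ.+ n) (F1perp r y)) (suc h ∷ t)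
      ≡⟨ coeff-++ (Hmul (ℤ.+ suc n) (F1perp (suc r) y)) (Hmul (ℤ.+ n) (F1perp r y)) (suc h ∷ t) ⟨
    coeff (Hmul (ℤ.+ suc n) (F1perp (suc r) y) ++ Hmul (ℤ.+ n) (F1perp r y)) (suc h ∷ t) ∎
    where
    p = 𝟙-positive t
    A = qsh (ones r) (suc h ∷ t)
    B = qsh (1 ∷ ones r) t
    C = qsh (ones r) t
    SA = ∑ A (coeff y)
    SB = ∑ B (coeff y)
    SC = ∑ C (coeff y)
    regroup : ∀ n → p * (δℕ (suc n) 1 * SA + (δℕ (suc n) (suc h) * SB + δℕ n (suc h) * SC))
                    ≡ δℕ (suc n) (suc h) * (p * SB) + coeff (Hmul (ℤ.+ n) (F1perp r y)) (suc h ∷ t)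
    regroup zero = trans
      (solve 5 (λ p b x y z → p :* (con 1ℚ :* x :+ (b :* y :+ con 0ℚ :* z)) := b :* (p :* y) :+ p :* x) refl
             p (δℕ 1 (suc h)) SA SB SC)
      (cong (δℕ 1 (suc h) * (p * SB) +_) (sym (coeff-Mperp (ones r) y (suc h ∷ t))))
    regroup (suc m) = trans
      (solve 6 (λ p b d x y z → p :* (con 0ℚ :* x :+ (b :* y :+ d :* z)) := b :* (p :* y) :+ d :* (p :* z)) refl
             p (δℕ (suc (suc m)) (suc h)) (δℕ (suc m) (suc h)) SA SB SC)
      (cong (δℕ (suc (suc m)) (suc h) * (p * SB) +_)
            (sym (trans (coeff-Hmul-∷ m (F1perp r y) (suc h) t) (cong (δℕ (suc m) (suc h) *_) (coeff-Mperp (ones r) y t)))))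
  at-[] : ∀ n → δℕ (suc n) 1 * coeff y (ones r) ≡ 0ℚ + coeff (Hmul (ℤ.+ n) (F1perp r y)) []
  at-[] zero    = trans (ℚ.*-identityˡ (coeff y (ones r)))
                    (sym (trans (ℚ.+-identityˡ (coeff (F1perp r y) [])) (coeff-Mperp-[] (ones r) y)))
  at-[] (suc m) = trans (ℚ.*-zeroˡ (coeff y (ones r)))
                    (sym (trans (ℚ.+-identityˡ (coeff (Hmul (ℤ.+ suc m) (F1perp r y)) [])) (coeff-Hmul-[] m (F1perp r y))))

F1perp-pred : ℕ → NSym → NSym
F1perp-pred zero    _ = []
F1perp-pred (suc r) x = F1perp r x

-- Dual to Δ F_{1^r} = Σᵢ F_{1^i} ⊗ F_{1^(r−i)}: only i ≤ 1 acts on H_k, and F_1^⊥ H_k = H_{k−1}.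
F1perp-Hmul : ∀ r k y → F1perp r (Hmul k y) ≈ Hmul k (F1perp r y) ++ Hmul (k ℤ.- ℤ.+ 1) (F1perp-pred r y)
F1perp-Hmul zero    k y = ≈.trans (F1perp-Hmul-0 k y)
  (≈.sym (≈.trans (++-cong ≈.refl (≈.reflexive (Hmul-[] (k ℤ.- ℤ.+ 1)))) (++-identityʳ _)))
F1perp-Hmul (suc r) k y = F1perp-Hmul-suc r k y

F1perp-scalar-0 : ∀ q → F1perp 0 ((q , []) ∷ []) ≈ (q , []) ∷ []
F1perp-scalar-0 q = mk≈ λ where
    []      → trans (coeff-F1perp-0 ((q , []) ∷ []) []) (ℚ.*-identityˡ _)
    (h ∷ t) → trans (coeff-F1perp-0 ((q , []) ∷ []) (h ∷ t)) (ℚ.*-zeroʳ (𝟙-positive (h ∷ t)))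

F1perp-scalar-suc : ∀ r q → F1perp (suc r) ((q , []) ∷ []) ≈ []
F1perp-scalar-suc r q = mk≈ λ c →
  trans (coeff-Mperp (ones (suc r)) ((q , []) ∷ []) c)
        (trans (cong (𝟙-positive c *_) (vanish c)) (ℚ.*-zeroʳ (𝟙-positive c)))
  where
  vanish : ∀ c → ∑ (qsh (ones (suc r)) c) (coeff ((q , []) ∷ [])) ≡ 0ℚ
  vanish []      = ℚ.+-identityʳ 0ℚ
  vanish (h ∷ t) = ∑-qsh-∷-vanish 1 (ones r) h t (λ _ → refl) (λ _ → refl) (λ _ → refl)

F1perp-zero-head : ∀ r q α → F1perp r ((q , zero ∷ α) ∷ []) ≈ []
F1perp-zero-head r q α = mk≈ (vanish r)
  where
  S = (q , zero ∷ α) ∷ []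
  vanish : ∀ r c → coeff (F1perp r S) c ≡ 0ℚ
  vanish zero    []          = coeff-Mperp-[] [] S
  vanish (suc r) []          = coeff-Mperp-[] (ones (suc r)) S
  vanish r       (zero ∷ t)  = Mperp-supported (ones r) S (zero ∷ t) refl
  vanish zero    (suc h ∷ t) = trans (coeff-F1perp-0 S (suc h ∷ t)) (ℚ.*-zeroʳ (𝟙-positive t))
  vanish (suc r) (suc h ∷ t) = trans (coeff-Mperp (ones (suc r)) S (suc h ∷ t))
    (trans (cong (𝟙-positive t *_) (∑-qsh-∷-vanish 1 (ones r) (suc h) t (λ _ → refl) (λ _ → refl) (λ _ → refl)))
           (ℚ.*-zeroʳ (𝟙-positive t)))

F1perp-F1perp-Hmul : ∀ r i k y →
  F1perp r (F1perp i (Hmul k y)) ≈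
    (Hmul k (F1perp r (F1perp i y)) ++ Hmul (k ℤ.- ℤ.+ 1) (F1perp-pred r (F1perp i y))) ++
    (Hmul (k ℤ.- ℤ.+ 1) (F1perp r (F1perp-pred i y)) ++ Hmul (k ℤ.- ℤ.+ 1 ℤ.- ℤ.+ 1) (F1perp-pred r (F1perp-pred i y)))
F1perp-F1perp-Hmul r i k y = begin
  F1perp r (F1perp i (Hmul k y))
    ≈⟨ Mperp-cong (ones r) (F1perp-Hmul i k y) ⟩
  F1perp r (Hmul k (F1perp i y) ++ Hmul (k ℤ.- ℤ.+ 1) (F1perp-pred i y))
    ≈⟨ Mperp-++ (ones r) (Hmul k (F1perp i y)) _ ⟩
  F1perp r (Hmul k (F1perp i y)) ++ F1perp r (Hmul (k ℤ.- ℤ.+ 1) (F1perp-pred i y))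
    ≈⟨ ++-cong (F1perp-Hmul r k (F1perp i y)) (F1perp-Hmul r (k ℤ.- ℤ.+ 1) (F1perp-pred i y)) ⟩
  _ ∎
  where open ≈-Reasoning

module _ {y : NSym} (comm : ∀ r i → F1perp r (F1perp i y) ≈ F1perp i (F1perp r y)) where

  F1perp-pred-F1perp-comm : ∀ r i → F1perp-pred r (F1perp i y) ≈ F1perp i (F1perp-pred r y)
  F1perp-pred-F1perp-comm zero    i = ≈.refl
  F1perp-pred-F1perp-comm (suc r) i = comm r i

  F1perp-pred-comm : ∀ r i → F1perp-pred r (F1perp-pred i y) ≈ F1perp-pred i (F1perp-pred r y)
  F1perp-pred-comm zero    zero    = ≈.refl
  F1perp-pred-comm zero    (suc i) = ≈.refl
  F1perp-pred-comm (suc r) zero    = ≈.refl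
  F1perp-pred-comm (suc r) (suc i) = comm r i

F1perp-comm-term : ∀ α q r i → F1perp r (F1perp i ((q , α) ∷ [])) ≈ F1perp i (F1perp r ((q , α) ∷ []))
F1perp-comm-term [] q zero    zero    = ≈.refl
F1perp-comm-term [] q r       (suc i) =
  ≈.trans (Mperp-cong (ones r) (F1perp-scalar-suc i q)) (≈.sym (killed r))
  where
  killed : ∀ r → F1perp (suc i) (F1perp r ((q , []) ∷ [])) ≈ []
  killed zero    = ≈.trans (Mperp-cong (ones (suc i)) (F1perp-scalar-0 q)) (F1perp-scalar-suc i q)
  killed (suc r) = Mperp-cong (ones (suc i)) (F1perp-scalar-suc r q)
F1perp-comm-term [] q (suc r) zero    = ≈.sym (F1perp-comm-term [] q zero (suc r))
F1perp-comm-term (zero ∷ α) q r i =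
  ≈.trans (Mperp-cong (ones r) (F1perp-zero-head i q α)) (≈.sym (Mperp-cong (ones i) (F1perp-zero-head r q α)))
-- The monomial q H_{n+1} H_α is Hmul (+ suc n) applied to q H_α by definition.
F1perp-comm-term (suc n ∷ α) q r i = begin
  F1perp r (F1perp i (Hmul k y))
    ≈⟨ F1perp-F1perp-Hmul r i k y ⟩
  (Hmul k (F1perp r (F1perp i y)) ++ Hmul k′ (F1perp-pred r (F1perp i y))) ++
  (Hmul k′ (F1perp r (F1perp-pred i y)) ++ Hmul k″ (F1perp-pred r (F1perp-pred i y)))
    ≈⟨ ++-cong (++-cong (Hmul-cong k (comm r i)) (Hmul-cong k′ (F1perp-pred-F1perp-comm comm r i)))
               (++-cong (Hmul-cong k′ (≈.sym (F1perp-pred-F1perp-comm comm i r))) (Hmul-cong k″ (F1perp-pred-comm comm r i))) ⟩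
  (Hmul k (F1perp i (F1perp r y)) ++ Hmul k′ (F1perp i (F1perp-pred r y))) ++
  (Hmul k′ (F1perp-pred i (F1perp r y)) ++ Hmul k″ (F1perp-pred i (F1perp-pred r y)))
    ≈⟨ ++-interchange (Hmul k (F1perp i (F1perp r y))) _ _ _ ⟩
  (Hmul k (F1perp i (F1perp r y)) ++ Hmul k′ (F1perp-pred i (F1perp r y))) ++
  (Hmul k′ (F1perp i (F1perp-pred r y)) ++ Hmul k″ (F1perp-pred i (F1perp-pred r y)))
    ≈⟨ F1perp-F1perp-Hmul i r k y ⟨
  F1perp i (F1perp r (Hmul k y)) ∎
  where
  open ≈-Reasoning
  y = (q , α) ∷ []
  k = ℤ.+ suc n
  k′ = k ℤ.- ℤ.+ 1
  k″ = k′ ℤ.- ℤ.+ 1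
  comm : ∀ r i → F1perp r (F1perp i y) ≈ F1perp i (F1perp r y)
  comm = F1perp-comm-term α q

F1perp-comm : ∀ r i x → F1perp r (F1perp i x) ≈ F1perp i (F1perp r x)
F1perp-comm r i []            = ≈.refl
F1perp-comm r i ((q , α) ∷ x) = begin
  F1perp r (F1perp i (S ++ x))                  ≈⟨ Mperp-cong (ones r) (Mperp-++ (ones i) S x) ⟩
  F1perp r (F1perp i S ++ F1perp i x)           ≈⟨ Mperp-++ (ones r) (F1perp i S) (F1perp i x) ⟩
  F1perp r (F1perp i S) ++ F1perp r (F1perp i x) ≈⟨ ++-cong (F1perp-comm-term α q r i) (F1perp-comm r i x) ⟩
  F1perp i (F1perp r S) ++ F1perp i (F1perp r x) ≈⟨ Mperp-++ (ones i) (F1perp r S) (F1perp r x) ⟨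
  F1perp i (F1perp r S ++ F1perp r x)           ≈⟨ Mperp-cong (ones i) (Mperp-++ (ones r) S x) ⟨
  F1perp i (F1perp r (S ++ x))                  ∎
  where
  open ≈-Reasoning
  S = (q , α) ∷ []

-- The operators 𝔹_m

coeff-above-degBound : ∀ x s → degBound x ℕ.< size s → coeff x s ≡ 0ℚ
coeff-above-degBound []            s _ = refl
coeff-above-degBound ((q , a) ∷ x) s deg<
  rewrite coeff-∷ q a x s
        | 𝟙-no (List.≡-dec ℕ._≟_ a s) (λ { refl → ℕ.<⇒≱ deg< (ℕ.m≤m+n (size a) (degBound x)) })
        | coeff-above-degBound x s (ℕ.<-≤-trans (ℕ.s≤s (ℕ.m≤n+m (degBound x) (size a))) deg<)
  = trans (cong (_+ 0ℚ) (ℚ.*-zeroˡ q)) (ℚ.+-identityʳ 0ℚ)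

size-ones : ∀ r → size (ones r) ≡ r
size-ones zero    = refl
size-ones (suc r) = cong suc (size-ones r)

F1perp-above-degBound : ∀ x i → degBound x ℕ.< i → F1perp i x ≈ []
F1perp-above-degBound x i deg< = mk≈ λ c →
  trans (coeff-Mperp (ones i) x c)
        (trans (cong (𝟙-positive c *_) (∑-zero (All.map (vanish c) (qsh-size (ones i) c)))) (ℚ.*-zeroʳ (𝟙-positive c)))
  where
  vanish : ∀ c {s} → size s ≡ size (ones i) ℕ.+ size c → coeff x s ≡ 0ℚ
  vanish c {s} |s|≡ = coeff-above-degBound x s (ℕ.<-≤-trans deg< (begin
    i                              ≡⟨ size-ones i ⟨
    size (ones i)                  ≤⟨ ℕ.m≤m+n (size (ones i)) (size c) ⟩
    size (ones i) ℕ.+ size c       ≡⟨ |s|≡ ⟨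
    size s                         ∎))
    where open ℕ.≤-Reasoning

𝔹-term : ℤ → NSym → ℕ → NSym
𝔹-term m x i = scale (sign i) (Hmul (m ℤ.+ ℤ.+ i) (F1perp i x))

𝔹≤ : ℤ → ℕ → NSym → NSym
𝔹≤ m N x = concatMap (𝔹-term m x) (upTo N)

𝔹≤-extend : ∀ m x N → degBound x ℕ.< N → 𝔹≤ m N x ≈ 𝔹≤ m (suc N) x
𝔹≤-extend m x N deg< = ≈.sym (begin
  concatMap (𝔹-term m x) (upTo (suc N))                  ≡⟨ cong (concatMap (𝔹-term m x)) (List.upTo-∷ʳ N) ⟨
  concatMap (𝔹-term m x) (upTo N List.∷ʳ N)              ≡⟨ List.concatMap-++ (𝔹-term m x) (upTo N) (N ∷ []) ⟩
  𝔹≤ m N x ++ (𝔹-term m x N ++ [])                       ≈⟨ ++-cong ≈.refl (++-identityʳ (𝔹-term m x N)) ⟩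
  𝔹≤ m N x ++ 𝔹-term m x N                               ≈⟨ ++-cong ≈.refl last-vanishes ⟩
  𝔹≤ m N x ++ []                                         ≈⟨ ++-identityʳ (𝔹≤ m N x) ⟩
  𝔹≤ m N x                                               ∎)
  where
  open ≈-Reasoning
  last-vanishes : 𝔹-term m x N ≈ []
  last-vanishes = ≈.trans (scale-cong (sign N) (Hmul-cong (m ℤ.+ ℤ.+ N) (F1perp-above-degBound x N deg<)))
                          (≈.reflexive (cong (scale (sign N)) (Hmul-[] (m ℤ.+ ℤ.+ N))))

-- 𝔹 m x cuts its series off at degBound x; the omitted terms vanish, so any later cutoff will do.
𝔹-truncate : ∀ m x N → degBound x ℕ.≤ N → 𝔹 m x ≈ 𝔹≤ m (suc N) x
𝔹-truncate m x N deg≤ with ℕ.m≤n⇒∃[o]m+o≡n deg≤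
... | d , refl = extend d
  where
  extend : ∀ d → 𝔹 m x ≈ 𝔹≤ m (suc (degBound x ℕ.+ d)) x
  extend zero    = ≈.reflexive (cong (λ n → 𝔹≤ m (suc n) x) (sym (ℕ.+-identityʳ (degBound x))))
  extend (suc d) = ≈.trans (extend d) (≈.trans (𝔹≤-extend m x _ (ℕ.s≤s (ℕ.m≤m+n (degBound x) d)))
                                               (≈.reflexive (cong (λ n → 𝔹≤ m (suc n) x) (sym (ℕ.+-suc (degBound x) d)))))

private
  ≤-+₁ : ∀ a b c → a ℕ.≤ a ℕ.+ (b ℕ.+ c)
  ≤-+₁ a b c = ℕ.m≤m+n a (b ℕ.+ c)
  ≤-+₂ : ∀ a b c → b ℕ.≤ a ℕ.+ (b ℕ.+ c)
  ≤-+₂ a b c = ℕ.≤-trans (ℕ.m≤m+n b c) (ℕ.m≤n+m (b ℕ.+ c) a)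
  ≤-+₃ : ∀ a b c → c ℕ.≤ a ℕ.+ (b ℕ.+ c)
  ≤-+₃ a b c = ℕ.≤-trans (ℕ.m≤n+m c b) (ℕ.m≤n+m (b ℕ.+ c) a)

𝔹-cong : ∀ m {x y} → x ≈ y → 𝔹 m x ≈ 𝔹 m y
𝔹-cong m {x} {y} x≈y = begin
  𝔹 m x
    ≈⟨ 𝔹-truncate m x N (ℕ.m≤m+n (degBound x) (degBound y)) ⟩
  𝔹≤ m (suc N) x
    ≈⟨ concatMap-cong (upTo (suc N)) (λ i → scale-cong (sign i) (Hmul-cong (m ℤ.+ ℤ.+ i) (Mperp-cong (ones i) x≈y))) ⟩
  𝔹≤ m (suc N) y
    ≈⟨ 𝔹-truncate m y N (ℕ.m≤n+m (degBound y) (degBound x)) ⟨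
  𝔹 m y ∎
  where
  open ≈-Reasoning
  N = degBound x ℕ.+ degBound y

𝔹-++ : ∀ m x y → 𝔹 m (x ++ y) ≈ 𝔹 m x ++ 𝔹 m y
𝔹-++ m x y = begin
  𝔹 m (x ++ y)
    ≈⟨ 𝔹-truncate m (x ++ y) N (≤-+₁ (degBound (x ++ y)) (degBound x) (degBound y)) ⟩
  concatMap (𝔹-term m (x ++ y)) (upTo (suc N))
    ≈⟨ concatMap-cong (upTo (suc N)) split ⟩
  concatMap (λ i → 𝔹-term m x i ++ 𝔹-term m y i) (upTo (suc N))
    ≈⟨ concatMap-++ (𝔹-term m x) (𝔹-term m y) (upTo (suc N)) ⟩
  𝔹≤ m (suc N) x ++ 𝔹≤ m (suc N) y
    ≈⟨ ++-cong (𝔹-truncate m x N (≤-+₂ (degBound (x ++ y)) (degBound x) (degBound y)))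
               (𝔹-truncate m y N (≤-+₃ (degBound (x ++ y)) (degBound x) (degBound y))) ⟨
  𝔹 m x ++ 𝔹 m y ∎
  where
  open ≈-Reasoning
  N = degBound (x ++ y) ℕ.+ (degBound x ℕ.+ degBound y)
  split : ∀ i → 𝔹-term m (x ++ y) i ≈ 𝔹-term m x i ++ 𝔹-term m y i
  split i = ≈.trans (scale-cong (sign i) (≈.trans (Hmul-cong (m ℤ.+ ℤ.+ i) (Mperp-++ (ones i) x y))
                                                  (Hmul-++ (m ℤ.+ ℤ.+ i) (F1perp i x) (F1perp i y))))
                    (scale-++ (sign i) (Hmul (m ℤ.+ ℤ.+ i) (F1perp i x)) (Hmul (m ℤ.+ ℤ.+ i) (F1perp i y)))

𝔹-[] : ∀ m → 𝔹 m [] ≈ []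
𝔹-[] m = ≈.trans (𝔹-truncate m [] 0 ℕ.z≤n)
                 (≈.reflexive (trans (List.++-identityʳ _) (cong (scale 1ℚ) (Hmul-[] (m ℤ.+ ℤ.+ 0)))))

𝔹-sumN : ∀ m xs → 𝔹 m (sumN xs) ≈ sumN (map (𝔹 m) xs)
𝔹-sumN m []       = 𝔹-[] m
𝔹-sumN m (x ∷ xs) = ≈.trans (𝔹-++ m x (sumN xs)) (++-cong ≈.refl (𝔹-sumN m xs))

F1perp-𝔹 : ∀ r m x → F1perp r (𝔹 m x) ≈ 𝔹 m (F1perp r x) ++ 𝔹 (m ℤ.- ℤ.+ 1) (F1perp-pred r x)
F1perp-𝔹 r m x = begin
  F1perp r (𝔹 m x)
    ≈⟨ Mperp-cong (ones r) (𝔹-truncate m x N (≤-+₁ D₁ D₂ D₃)) ⟩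
  F1perp r (concatMap (𝔹-term m x) (upTo (suc N)))
    ≈⟨ Mperp-concatMap (ones r) (𝔹-term m x) (upTo (suc N)) ⟩
  concatMap (F1perp r ∘ 𝔹-term m x) (upTo (suc N))
    ≈⟨ concatMap-cong (upTo (suc N)) term ⟩
  concatMap (λ i → 𝔹-term m (F1perp r x) i ++ 𝔹-term (m ℤ.- ℤ.+ 1) (F1perp-pred r x) i) (upTo (suc N))
    ≈⟨ concatMap-++ (𝔹-term m (F1perp r x)) (𝔹-term (m ℤ.- ℤ.+ 1) (F1perp-pred r x)) (upTo (suc N)) ⟩
  𝔹≤ m (suc N) (F1perp r x) ++ 𝔹≤ (m ℤ.- ℤ.+ 1) (suc N) (F1perp-pred r x)
    ≈⟨ ++-cong (𝔹-truncate m (F1perp r x) N (≤-+₂ D₁ D₂ D₃))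
               (𝔹-truncate (m ℤ.- ℤ.+ 1) (F1perp-pred r x) N (≤-+₃ D₁ D₂ D₃)) ⟨
  𝔹 m (F1perp r x) ++ 𝔹 (m ℤ.- ℤ.+ 1) (F1perp-pred r x) ∎
  where
  open ≈-Reasoning
  D₁ = degBound x
  D₂ = degBound (F1perp r x)
  D₃ = degBound (F1perp-pred r x)
  N = D₁ ℕ.+ (D₂ ℕ.+ D₃)
  shift : ∀ m j → m ℤ.+ j ℤ.- ℤ.+ 1 ≡ m ℤ.- ℤ.+ 1 ℤ.+ j
  shift = ℤ-Solver.solve-∀
  pred-comm : ∀ r i → F1perp-pred r (F1perp i x) ≈ F1perp i (F1perp-pred r x)
  pred-comm = F1perp-pred-F1perp-comm (λ a b → F1perp-comm a b x)
  term : ∀ i → F1perp r (𝔹-term m x i) ≈ 𝔹-term m (F1perp r x) i ++ 𝔹-term (m ℤ.- ℤ.+ 1) (F1perp-pred r x) i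
  term i = begin
    F1perp r (scale (sign i) (Hmul (m ℤ.+ ℤ.+ i) (F1perp i x)))
      ≈⟨ Mperp-scale (ones r) (sign i) (Hmul (m ℤ.+ ℤ.+ i) (F1perp i x)) ⟩
    scale (sign i) (F1perp r (Hmul (m ℤ.+ ℤ.+ i) (F1perp i x)))
      ≈⟨ scale-cong (sign i) (F1perp-Hmul r (m ℤ.+ ℤ.+ i) (F1perp i x)) ⟩
    scale (sign i) (Hmul (m ℤ.+ ℤ.+ i) (F1perp r (F1perp i x)) ++ Hmul (m ℤ.+ ℤ.+ i ℤ.- ℤ.+ 1) (F1perp-pred r (F1perp i x)))
      ≈⟨ scale-++ (sign i) (Hmul (m ℤ.+ ℤ.+ i) (F1perp r (F1perp i x))) (Hmul (m ℤ.+ ℤ.+ i ℤ.- ℤ.+ 1) (F1perp-pred r (F1perp i x))) ⟩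
    scale (sign i) (Hmul (m ℤ.+ ℤ.+ i) (F1perp r (F1perp i x))) ++
    scale (sign i) (Hmul (m ℤ.+ ℤ.+ i ℤ.- ℤ.+ 1) (F1perp-pred r (F1perp i x)))
      ≈⟨ ++-cong (scale-cong (sign i) (Hmul-cong (m ℤ.+ ℤ.+ i) (F1perp-comm r i x)))
                 (scale-cong (sign i) (≈.trans (Hmul-cong (m ℤ.+ ℤ.+ i ℤ.- ℤ.+ 1) (pred-comm r i))
                                               (≈.reflexive (cong (λ k → Hmul k (F1perp i (F1perp-pred r x))) (shift m (ℤ.+ i)))))) ⟩
    𝔹-term m (F1perp r x) i ++ 𝔹-term (m ℤ.- ℤ.+ 1) (F1perp-pred r x) i ∎

-- The sum over β

coeff-sumN-filter : {A : Set} {P : A → Set} (P? : Decidable P) (h : A → NSym) (l : List A) (c : Composition) →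
                    coeff (sumN (map h (filter P? l))) c ≡ ∑ l (λ a → 𝟙 (does (P? a)) * coeff (h a) c)
coeff-sumN-filter P? h []      c = refl
coeff-sumN-filter P? h (a ∷ l) c with does (P? a)
... | true  = trans (coeff-++ (h a) (sumN (map h (filter P? l))) c)
                    (cong₂ _+_ (sym (ℚ.*-identityˡ (coeff (h a) c))) (coeff-sumN-filter P? h l c))
... | false = trans (coeff-sumN-filter P? h l c)
                    (sym (trans (cong (_+ _) (ℚ.*-zeroˡ (coeff (h a) c))) (ℚ.+-identityˡ _)))

coeff-sumN-betas : ∀ {m} r (α : Vec ℤ m) (g : Vec ℤ m → NSym) c →
                   coeff (sumN (map g (betas r α))) c ≡ ∑ (allBools m) (λ ε → δℕ (countTrue ε) r * coeff (g (subtractε α ε)) c)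
coeff-sumN-betas {m} r α g c = trans
  (cong (λ l → coeff (sumN l) c) (sym (List.map-∘ (filter (λ ε → countTrue ε ℕ.≟ r) (allBools m)))))
  (coeff-sumN-filter (λ ε → countTrue ε ℕ.≟ r) (g ∘ subtractε α) (allBools m) c)

Σ𝔖 : ∀ {m} → ℕ → Vec ℤ m → NSym
Σ𝔖 r α = sumN (map 𝔖 (betas r α))

Σ𝔖-pred : ∀ {m} → ℕ → Vec ℤ m → NSym
Σ𝔖-pred zero    α = []
Σ𝔖-pred (suc r) α = Σ𝔖 r α

-- β = (a, β′) or (a − 1, β′), according to the first bit of ε.
Σ𝔖-∷ : ∀ {m} r a (α : Vec ℤ m) → Σ𝔖 r (a Vec.∷ α) ≈ 𝔹 a (Σ𝔖 r α) ++ 𝔹 (a ℤ.- ℤ.+ 1) (Σ𝔖-pred r α)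
Σ𝔖-∷ {m} r a α = mk≈ λ c → begin
  coeff (Σ𝔖 r (a Vec.∷ α)) c
    ≡⟨ coeff-sumN-betas r (a Vec.∷ α) 𝔖 c ⟩
  ∑ (allBools (suc m)) (λ ε → δℕ (countTrue ε) r * coeff (𝔖 (subtractε (a Vec.∷ α) ε)) c)
    ≡⟨ ∑-concatMap (λ v → (false Vec.∷ v) ∷ (true Vec.∷ v) ∷ []) (allBools m) _ ⟩
  ∑ (allBools m) (λ v → δℕ (countTrue v) r * B a v c + (δℕ (suc (countTrue v)) r * B (a ℤ.- ℤ.+ 1) v c + 0ℚ))
    ≡⟨ ∑-cong (allBools m) (λ v → cong (δℕ (countTrue v) r * B a v c +_) (ℚ.+-identityʳ _)) ⟩
  ∑ (allBools m) (λ v → δℕ (countTrue v) r * B a v c + δℕ (suc (countTrue v)) r * B (a ℤ.- ℤ.+ 1) v c)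
    ≡⟨ ∑-+ (allBools m) _ _ ⟩
  ∑ (allBools m) (λ v → δℕ (countTrue v) r * B a v c) + ∑ (allBools m) (λ v → δℕ (suc (countTrue v)) r * B (a ℤ.- ℤ.+ 1) v c)
    ≡⟨ cong₂ _+_ (coeff-𝔹-Σ𝔖 a r c) (coeff-𝔹-Σ𝔖-pred r c) ⟨
  coeff (𝔹 a (Σ𝔖 r α)) c + coeff (𝔹 (a ℤ.- ℤ.+ 1) (Σ𝔖-pred r α)) c
    ≡⟨ coeff-++ (𝔹 a (Σ𝔖 r α)) (𝔹 (a ℤ.- ℤ.+ 1) (Σ𝔖-pred r α)) c ⟨
  coeff (𝔹 a (Σ𝔖 r α) ++ 𝔹 (a ℤ.- ℤ.+ 1) (Σ𝔖-pred r α)) c ∎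
  where
  open ≡-Reasoning
  B : ℤ → Vec Bool m → Composition → ℚ
  B b v c = coeff (𝔹 b (𝔖 (subtractε α v))) c
  coeff-𝔹-Σ𝔖 : ∀ b r c → coeff (𝔹 b (Σ𝔖 r α)) c ≡ ∑ (allBools m) (λ v → δℕ (countTrue v) r * B b v c)
  coeff-𝔹-Σ𝔖 b r c = begin
    coeff (𝔹 b (Σ𝔖 r α)) c                      ≡⟨ coeff-≈ (𝔹-sumN b (map 𝔖 (betas r α))) c ⟩
    coeff (sumN (map (𝔹 b) (map 𝔖 (betas r α)))) c ≡⟨ cong (λ l → coeff (sumN l) c) (List.map-∘ (betas r α)) ⟨
    coeff (sumN (map (𝔹 b ∘ 𝔖) (betas r α))) c  ≡⟨ coeff-sumN-betas r α (𝔹 b ∘ 𝔖) c ⟩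
    ∑ (allBools m) (λ v → δℕ (countTrue v) r * B b v c) ∎
  coeff-𝔹-Σ𝔖-pred : ∀ r c → coeff (𝔹 (a ℤ.- ℤ.+ 1) (Σ𝔖-pred r α)) c
                           ≡ ∑ (allBools m) (λ v → δℕ (suc (countTrue v)) r * B (a ℤ.- ℤ.+ 1) v c)
  coeff-𝔹-Σ𝔖-pred zero    c = trans (coeff-≈ (𝔹-[] (a ℤ.- ℤ.+ 1)) c)
    (sym (trans (∑-cong (allBools m) (λ v → ℚ.*-zeroˡ (B (a ℤ.- ℤ.+ 1) v c))) (∑-const-zero (allBools m))))
  coeff-𝔹-Σ𝔖-pred (suc r) c = coeff-𝔹-Σ𝔖 (a ℤ.- ℤ.+ 1) r c

F1perp-𝔖 : ∀ {m} r (α : Vec ℤ m) → F1perp r (𝔖 α) ≈ Σ𝔖 r α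
F1perp-𝔖 zero    Vec.[]       = ≈.trans (F1perp-scalar-0 1ℚ) (≈.sym (++-identityʳ oneN))
F1perp-𝔖 (suc r) Vec.[]       = F1perp-scalar-suc r 1ℚ
F1perp-𝔖 r       (a Vec.∷ α) = begin
  F1perp r (𝔹 a (𝔖 α))
    ≈⟨ F1perp-𝔹 r a (𝔖 α) ⟩
  𝔹 a (F1perp r (𝔖 α)) ++ 𝔹 (a ℤ.- ℤ.+ 1) (F1perp-pred r (𝔖 α))
    ≈⟨ ++-cong (𝔹-cong a (F1perp-𝔖 r α)) (𝔹-cong (a ℤ.- ℤ.+ 1) (F1perp-pred-𝔖 r)) ⟩
  𝔹 a (Σ𝔖 r α) ++ 𝔹 (a ℤ.- ℤ.+ 1) (Σ𝔖-pred r α)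
    ≈⟨ Σ𝔖-∷ r a α ⟨
  Σ𝔖 r (a Vec.∷ α) ∎
  where
  open ≈-Reasoning
  F1perp-pred-𝔖 : ∀ r → F1perp-pred r (𝔖 α) ≈ Σ𝔖-pred r α
  F1perp-pred-𝔖 zero    = ≈.refl
  F1perp-pred-𝔖 (suc r) = F1perp-𝔖 r α

countTrue-≤ : ∀ {m} (ε : Vec Bool m) → countTrue ε ℕ.≤ m
countTrue-≤ Vec.[]          = ℕ.z≤n
countTrue-≤ (true Vec.∷ ε)  = ℕ.s≤s (countTrue-≤ ε)
countTrue-≤ (false Vec.∷ ε) = ℕ.m≤n⇒m≤1+n (countTrue-≤ ε)

betas-empty : ∀ {m} r (α : Vec ℤ m) → r > m → betas r α ≡ []
betas-empty {m} r α m<r = cong (map (subtractε α))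
  (List.filter-none (λ ε → countTrue ε ℕ.≟ r) {allBools m} (All.universal countTrue≢r _))
  where
  countTrue≢r : ∀ ε → ¬ countTrue ε ≡ r
  countTrue≢r ε ε≡r = ℕ.<⇒≱ m<r (ℕ.≤-trans (ℕ.≤-reflexive (sym ε≡r)) (countTrue-≤ ε))

proposition3p34 : (m r : ℕ) (α : Vec ℤ m) →
    (F1perp r (𝔖 α) ≈N sumN (map 𝔖 (betas r α)))
    × (r > m → F1perp r (𝔖 α) ≈N zeroN)
proposition3p34 m r α =
  coeff-≈ (F1perp-𝔖 r α) ,
  λ m<r c → trans (coeff-≈ (F1perp-𝔖 r α) c) (cong (λ β → coeff (sumN (map 𝔖 β)) c) (betas-empty r α m<r))
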